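{- Let $s<t$ be relatively prime positive integers, and use the convention $\overline{\{m\}}=\emptyset$ for integers $m\le 0$. Then: (i) for positive integers $i,j$, $\overline{\{i\}}-j=\overline{\{i-j\}}$; (ii) for positive integers $i,j$, $\overline{\overline{\{i\}}+j}=\overline{\{i+j\}}$; (iii) for a positive integer $i$, if $\{s,t\}\cap\overline{\{i\}}=\emptyset$ then $|\overline{\{i+1\}}|-|\overline{\{i\}}|=0$, and otherwise $|\overline{\{i+1\}}|-|\overline{\{i\}}|=1$; (iv) for every integer $n\ge0$ there is an integer $i\ge 0$ with $|\overline{\{i\}}|=n$; (v) for positive integers $a,b$: $a\le b$ if and only if $\overline{\{a\}}\prec\overline{\{b\}}$; (vi) for positive integers $a,b$: $|\overline{\{a\}}|<|\overline{\{b\}}|$ implies $a<b$.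
   Context: The $(s,t)$-closure of a set $\beta$ of integers is $\overline{\beta}=\{x-as-bt : x\in\beta,\ a,b\ge0 \text{ integers},\ x>as+bt\}$. For a finite set $\beta$ of positive integers and a positive integer $k$: $\beta+k=\{x+k:x\in\beta\}$ and $\beta-k=\{x-k:x\in\beta,\ x>k\}$. A beta-set is a finite set of positive integers written decreasingly $\beta=\{\beta_1>\dots>\beta_n\}$, with associated partition $P(\beta)=(\beta_1-(n-1),\dots,\beta_n)$. For partitions $P=(P_1,\dots,P_n)$, $Q=(Q_1,\dots,Q_m)$ write $P<Q$ if $n\le m$ and $P_i\le Q_i$ for $i\le n$; for beta-sets $\beta\prec\gamma$ means $P(\beta)<P(\gamma)$. -}

module Defs where

open import Data.Nat using (ℕ; zero; suc; _+_; _*_; _∸_; _≤_; _<_; _>_)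
open import Data.Nat.Coprimality using (Coprime)
open import Data.List using (List; []; _∷_; length)
open import Data.List.Membership.Propositional using (_∈_)
open import Data.List.Relation.Unary.Linked using (Linked)
open import Data.Product using (Σ; _×_; ∃-syntax)
open import Function.Bundles using (_⇔_)
open import Relation.Binary.PropositionalEquality using (_≡_)

NSet : Set₁
NSet = ℕ → Set

｛_｝ : ℕ → NSet
｛ m ｝ = λ x → x ≡ m

_≐_ : NSet → NSet → Set
A ≐ B = ∀ y → A y ⇔ B y

_⊕_ : NSet → ℕ → NSet
(β ⊕ k) y = Σ ℕ λ x → β x × y ≡ x + k

_⊖_ : NSet → ℕ → NSet
(β ⊖ k) y = Σ ℕ λ x → β x × k < x × y ≡ x ∸ k

closure : ℕ → ℕ → NSet → NSet
closure s t β y =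
  Σ ℕ λ x → Σ ℕ λ a → Σ ℕ λ b →
    β x × a * s + b * t < x × y ≡ x ∸ (a * s + b * t)

Enumerates : NSet → List ℕ → Set
Enumerates S xs = Linked _>_ xs × (∀ y → (y ∈ xs) ⇔ S y)

HasSize : NSet → ℕ → Set
HasSize S n = Σ (List ℕ) λ xs → Enumerates S xs × length xs ≡ n

-- partition of a decreasingly written beta-set β₁ > … > βₙ:
-- (β₁ - (n-1), …, βₖ - (n-k), …, βₙ)
partitionOf : List ℕ → List ℕ
partitionOf []       = []
partitionOf (x ∷ xs) = (x ∸ length xs) ∷ partitionOf xs

data _⊴_ : List ℕ → List ℕ → Set where
  []⊴  : ∀ {Q} → [] ⊴ Q
  _∷⊴_ : ∀ {p q P Q} → p ≤ q → P ⊴ Q → (p ∷ P) ⊴ (q ∷ Q)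

_≺_ : NSet → NSet → Set
β ≺ γ = Σ (List ℕ) λ xs → Σ (List ℕ) λ ys →
  Enumerates β xs × Enumerates γ ys × partitionOf xs ⊴ partitionOf ys

-- The closure of a singleton is explicit: y ∈ closure {i} iff 0 < y ≤ i and i − y is
-- representable as a s + b t. Parts (i) and (ii) are arithmetic on these representations.
-- Listing the closure of {i} decreasingly, the list for i + 1 is the list for i shifted up by
-- one, followed by 1 exactly when i is representable; this is (iii). Hence the size grows by
-- steps of at most one and is unbounded, giving (iv); it is monotone, giving (vi); and shifting
-- up does not decrease the parts of the partition while appending 1 adds a part, giving (v) ⇒.
-- For (v) ⇐, if b < a then both sets have the same size r, and the first parts a − (r − 1) and
-- b − (r − 1) compare as a and b.
module Submission where

open import Defs
open import Data.Nat using (ℕ; zero; suc; _+_; _*_; _∸_; _≤_; _<_; _>_; _≤′_; ≤′-step;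
  ≤′-refl; z≤n; s≤s; s≤s⁻¹; z<s; _≟_; _≤?_; >-nonZero)
open import Data.Nat.Properties
open import Data.Nat.Coprimality using (Coprime)
open import Data.Nat.Solver using (module +-*-Solver)
open import Data.List using (List; []; _∷_; _∷ʳ_; _++_; length; map; filter; applyDownFrom)
open import Data.List.Properties
  using (length-++; length-map; ++-identityʳ; filter-accept; filter-reject; length-filter;
         length-applyDownFrom)
open import Data.List.Membership.Propositional using (_∈_)
open import Data.List.Membership.Propositional.Properties
  using (∈-filter⁺; ∈-filter⁻; ∈-applyDownFrom⁺; ∈-applyDownFrom⁻)
import Data.List.Relation.Unary.All as All
open import Data.List.Relation.Unary.AllPairs using (_∷_)
open import Data.List.Relation.Unary.Any using (here; there)
open import Data.List.Relation.Unary.Linked using (Linked; tail)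
open import Data.List.Relation.Unary.Linked.Properties
  using (Linked⇒AllPairs; filter⁺; applyDownFrom⁺₂)
open import Data.Product using (Σ; _×_; _,_; ∃; ∃₂)
open import Data.Sum using (_⊎_; inj₁; inj₂; [_,_]′)
open import Function.Base using (_∘_)
open import Function.Bundles using (_⇔_; mk⇔; Equivalence)
import Function.Properties.Equivalence as ⇔
open import Relation.Binary.Core using (Rel)
open import Relation.Binary.Definitions using (Reflexive; Transitive)
open import Relation.Binary.PropositionalEquality
open import Relation.Nullary using (¬_; Dec; yes; no; contradiction)
import Relation.Nullary.Decidable as Dec

open Equivalence using (to; from)
open +-*-Solver

stepwise⇒monotone : ∀ {a ℓ} {A : Set a} {_≲_ : Rel A ℓ} → Reflexive _≲_ → Transitive _≲_ →
  (f : ℕ → A) → (∀ n → f n ≲ f (suc n)) → ∀ {m n} → m ≤ n → f m ≲ f n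
stepwise⇒monotone {_≲_ = _≲_} ≲-refl ≲-trans f step m≤n = go (≤⇒≤′ m≤n)
  where
  go : ∀ {m n} → m ≤′ n → f m ≲ f n
  go ≤′-refl = ≲-refl
  go (≤′-step m≤′n) = ≲-trans (go m≤′n) (step _)

unitSteps⇒attains : (f : ℕ → ℕ) → f 0 ≡ 0 → (∀ k → f (suc k) ≤ suc (f k)) →
  ∀ {n} k → n ≤ f k → ∃ λ j → f j ≡ n
unitSteps⇒attains f f0≡0 step zero n≤f0 = 0 , trans f0≡0 (sym (n≤0⇒n≡0 (subst (_ ≤_) f0≡0 n≤f0)))
unitSteps⇒attains f f0≡0 step {n} (suc k) n≤fk+1 with n ≤? f k
... | yes n≤fk = unitSteps⇒attains f f0≡0 step k n≤fk
... | no n≰fk  = suc k , ≤-antisym (≤-trans (step k) (≰⇒> n≰fk)) n≤fk+1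

<∸⇒+< : ∀ {m n o} → m < n ∸ o → o + m < n
<∸⇒+< {o = zero} m<n = m<n
<∸⇒+< {n = suc n} {o = suc o} m<n∸o = s≤s (<∸⇒+< m<n∸o)

<∸-swap : ∀ {m n o} → m < n ∸ o → o < n ∸ m
<∸-swap {o = o} m<n∸o = m+n≤o⇒m≤o∸n (suc o) (<∸⇒+< m<n∸o)

∸-∸-comm : ∀ m n o → m ∸ n ∸ o ≡ m ∸ o ∸ n
∸-∸-comm m n o = begin
  m ∸ n ∸ o   ≡⟨ ∸-+-assoc m n o ⟩
  m ∸ (n + o) ≡⟨ cong (m ∸_) (+-comm n o) ⟩
  m ∸ (o + n) ≡⟨ ∸-+-assoc m o n ⟨
  m ∸ o ∸ n   ∎
  where open ≡-Reasoning

-- Strictly decreasing lists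

>-trans : Transitive _>_
>-trans x>y y>z = <-trans y>z x>y

tail<head : ∀ {x y xs} → Linked _>_ (x ∷ xs) → y ∈ xs → y < x
tail<head lk y∈xs with x>xs ∷ _ ← Linked⇒AllPairs >-trans lk = All.lookup x>xs y∈xs

≤head : ∀ {x y xs} → Linked _>_ (x ∷ xs) → y ∈ x ∷ xs → y ≤ x
≤head _  (here refl)  = ≤-refl
≤head lk (there y∈xs) = <⇒≤ (tail<head lk y∈xs)

∈-tail : ∀ {x z xs ys} → Linked _>_ (x ∷ xs) → z ∈ xs → z ∈ x ∷ ys → z ∈ ys
∈-tail lk z∈xs (here refl)  = contradiction (tail<head lk z∈xs) (<-irrefl refl)
∈-tail _  _    (there z∈ys) = z∈ys

decreasing-unique : ∀ {xs ys} → Linked _>_ xs → Linked _>_ ys →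
  (∀ z → z ∈ xs ⇔ z ∈ ys) → xs ≡ ys
decreasing-unique {[]}    {[]}    _ _ _ = refl
decreasing-unique {[]}    {y ∷ _} _ _ same with () ← from (same y) (here refl)
decreasing-unique {x ∷ _} {[]}    _ _ same with () ← to (same x) (here refl)
decreasing-unique {x ∷ xs} {y ∷ ys} lx ly same
  with refl ← ≤-antisym (≤head ly (to (same x) (here refl))) (≤head lx (from (same y) (here refl)))
  = cong (x ∷_) (decreasing-unique (tail lx) (tail ly) λ z →
      mk⇔ (λ z∈xs → ∈-tail lx z∈xs (to (same z) (there z∈xs)))
          (λ z∈ys → ∈-tail ly z∈ys (from (same z) (there z∈ys))))

Enumerates-unique : ∀ {S xs ys} → Enumerates S xs → Enumerates S ys → xs ≡ ys
Enumerates-unique (lx , xs≈S) (ly , ys≈S) =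
  decreasing-unique lx ly λ z → ⇔.trans (xs≈S z) (⇔.sym (ys≈S z))

HasSize-unique : ∀ {S n xs} → HasSize S n → Enumerates S xs → n ≡ length xs
HasSize-unique (_ , enum , refl) enum′ = cong length (Enumerates-unique enum enum′)

∈-applyDownFrom-suc⇔ : ∀ {n y} → y ∈ applyDownFrom suc n ⇔ (0 < y × y ≤ n)
∈-applyDownFrom-suc⇔ = mk⇔ bounds (λ { (z<s , y≤n) → ∈-applyDownFrom⁺ suc y≤n })
  where
  bounds : ∀ {n y} → y ∈ applyDownFrom suc n → 0 < y × y ≤ n
  bounds y∈ with _ , k<n , refl ← ∈-applyDownFrom⁻ suc y∈ = z<s , k<n

length-∷ʳ : ∀ {a} {A : Set a} (xs : List A) x → length (xs ∷ʳ x) ≡ suc (length xs)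
length-∷ʳ xs x = trans (length-++ xs) (+-comm (length xs) 1)

-- Partitions

⊴-refl : Reflexive _⊴_
⊴-refl {[]}    = []⊴
⊴-refl {_ ∷ _} = ≤-refl ∷⊴ ⊴-refl

⊴-trans : Transitive _⊴_
⊴-trans []⊴           _             = []⊴
⊴-trans (p≤q ∷⊴ P⊴Q) (q≤r ∷⊴ Q⊴R) = ≤-trans p≤q q≤r ∷⊴ ⊴-trans P⊴Q Q⊴R

⊴-++ : ∀ P Q → P ⊴ (P ++ Q)
⊴-++ []      Q = []⊴
⊴-++ (_ ∷ P) Q = ≤-refl ∷⊴ ⊴-++ P Q

⊴⇒length≤ : ∀ {P Q} → P ⊴ Q → length P ≤ length Q
⊴⇒length≤ []⊴       = z≤n
⊴⇒length≤ (_ ∷⊴ P⊴Q) = s≤s (⊴⇒length≤ P⊴Q)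

length-partitionOf : ∀ xs → length (partitionOf xs) ≡ length xs
length-partitionOf []       = refl
length-partitionOf (_ ∷ xs) = cong suc (length-partitionOf xs)

partitionOf-⊴-map-suc : ∀ xs → partitionOf xs ⊴ partitionOf (map suc xs)
partitionOf-⊴-map-suc []       = []⊴
partitionOf-⊴-map-suc (x ∷ xs) rewrite length-map suc xs =
  ∸-monoˡ-≤ (length xs) (n≤1+n x) ∷⊴ partitionOf-⊴-map-suc xs

partitionOf-map-suc-∷ʳ-1 : ∀ xs → partitionOf (map suc xs ∷ʳ 1) ≡ partitionOf xs ∷ʳ 1
partitionOf-map-suc-∷ʳ-1 []       = refl
partitionOf-map-suc-∷ʳ-1 (x ∷ xs) =
  cong₂ _∷_ (cong (suc x ∸_) (trans (length-∷ʳ (map suc xs) 1) (cong suc (length-map suc xs))))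
            (partitionOf-map-suc-∷ʳ-1 xs)

partitionOf-⊴⇒head≤ : ∀ {x y xs ys} → partitionOf (x ∷ xs) ⊴ partitionOf (y ∷ ys) →
  length ys ≤ length xs → length ys ≤ y → x ≤ y
partitionOf-⊴⇒head≤ {x} {y} {xs} {ys} (head≤ ∷⊴ rest) ys≤xs ys≤y = begin
  x           ≤⟨ m≤n+m∸n x r ⟩
  r + (x ∸ r) ≤⟨ +-monoʳ-≤ r (subst (λ l → x ∸ r ≤ y ∸ l) ys≡xs head≤) ⟩
  r + (y ∸ r) ≡⟨ m+[n∸m]≡n (subst (_≤ y) ys≡xs ys≤y) ⟩
  y           ∎
  where
  open ≤-Reasoning
  r : ℕ
  r = length xs
  ys≡xs : length ys ≡ r
  ys≡xs = ≤-antisym ys≤xs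
    (subst₂ _≤_ (length-partitionOf xs) (length-partitionOf ys) (⊴⇒length≤ rest))

-- Closures of singletons

Representable : ℕ → ℕ → ℕ → Set
Representable s t m = ∃₂ λ a b → a * s + b * t ≡ m

module _ {s t : ℕ} where

  representable-s+ : ∀ {m} → Representable s t m → Representable s t (s + m)
  representable-s+ (a , b , refl) = suc a , b , +-assoc s (a * s) (b * t)

  representable-t+ : ∀ {m} → Representable s t m → Representable s t (t + m)
  representable-t+ (a , b , refl) = a , suc b ,
    solve 4 (λ a b s t → a :* s :+ (t :+ b :* t) := t :+ (a :* s :+ b :* t)) refl a b s t

  closure-singleton⇔ : ∀ {i y} →
    closure s t ｛ i ｝ y ⇔ ((0 < y × y ≤ i) × Representable s t (i ∸ y))
  closure-singleton⇔ {i} {y} = mk⇔ characterise witness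
    where
    characterise : closure s t ｛ i ｝ y → (0 < y × y ≤ i) × Representable s t (i ∸ y)
    characterise (_ , a , b , refl , m<i , refl) =
      (m<n⇒0<n∸m m<i , m∸n≤m i (a * s + b * t)) , a , b , sym (m∸[m∸n]≡n (<⇒≤ m<i))
    witness : (0 < y × y ≤ i) × Representable s t (i ∸ y) → closure s t ｛ i ｝ y
    witness ((0<y , y≤i) , a , b , m≡i∸y) = i , a , b , refl ,
      subst (_< i) (sym m≡i∸y) (∸-monoʳ-< 0<y y≤i) ,
      trans (sym (m∸[m∸n]≡n y≤i)) (cong (i ∸_) (sym m≡i∸y))

  closure-singleton-⊖ : ∀ i j → (closure s t ｛ i ｝ ⊖ j) ≐ closure s t ｛ i ∸ j ｝
  closure-singleton-⊖ i j y = mk⇔ shiftDown shiftUp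
    where
    shiftDown : (closure s t ｛ i ｝ ⊖ j) y → closure s t ｛ i ∸ j ｝ y
    shiftDown (_ , (_ , a , b , refl , _ , refl) , j<x , refl) =
      i ∸ j , a , b , refl , <∸-swap j<x , ∸-∸-comm i (a * s + b * t) j
    shiftUp : closure s t ｛ i ∸ j ｝ y → (closure s t ｛ i ｝ ⊖ j) y
    shiftUp (_ , a , b , refl , m<i∸j , refl) =
      i ∸ (a * s + b * t) , (i , a , b , refl , <-≤-trans m<i∸j (m∸n≤m i j) , refl) ,
      <∸-swap m<i∸j , ∸-∸-comm i j (a * s + b * t)

  closure-closure-singleton-⊕ : ∀ {i} → 0 < i → ∀ j →
    closure s t (closure s t ｛ i ｝ ⊕ j) ≐ closure s t ｛ i + j ｝
  closure-closure-singleton-⊕ {i} 0<i j y = mk⇔ compose decompose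
    where
    combination-+ : ∀ a₀ a b₀ b → (a₀ + a) * s + (b₀ + b) * t ≡ (a₀ * s + b₀ * t) + (a * s + b * t)
    combination-+ a₀ a b₀ b = solve 6 (λ a₀ a b₀ b s t →
      (a₀ :+ a) :* s :+ (b₀ :+ b) :* t := (a₀ :* s :+ b₀ :* t) :+ (a :* s :+ b :* t)) refl a₀ a b₀ b s t
    compose : closure s t (closure s t ｛ i ｝ ⊕ j) y → closure s t ｛ i + j ｝ y
    compose (_ , a , b , (_ , (_ , a₀ , b₀ , refl , m₀<i , refl) , refl) , m<x , refl) =
      i + j , a₀ + a , b₀ + b , refl ,
      subst (_< i + j) (sym (combination-+ a₀ a b₀ b)) (<∸⇒+< {o = m₀} (subst (m <_) x≡ m<x)) ,
      (begin
        (i ∸ m₀ + j) ∸ m  ≡⟨ cong (_∸ m) x≡ ⟩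
        (i + j) ∸ m₀ ∸ m  ≡⟨ ∸-+-assoc (i + j) m₀ m ⟩
        (i + j) ∸ (m₀ + m) ≡⟨ cong ((i + j) ∸_) (combination-+ a₀ a b₀ b) ⟨
        (i + j) ∸ ((a₀ + a) * s + (b₀ + b) * t) ∎)
      where
      open ≡-Reasoning
      m₀ m : ℕ
      m₀ = a₀ * s + b₀ * t
      m  = a * s + b * t
      x≡ : i ∸ m₀ + j ≡ (i + j) ∸ m₀
      x≡ = sym (+-∸-comm j (<⇒≤ m₀<i))
    decompose : closure s t ｛ i + j ｝ y → closure s t (closure s t ｛ i ｝ ⊕ j) y
    decompose (_ , a , b , refl , m<i+j , refl) =
      i + j , a , b , (i , (i , 0 , 0 , refl , 0<i , refl) , refl) , m<i+j , refl

  generator∈closure : ∀ {g m} → 0 < g → Representable s t m → closure s t ｛ g + m ｝ g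
  generator∈closure {g} {m} 0<g r =
    from closure-singleton⇔ ((0<g , m≤m+n g m) , subst (Representable s t) (sym (m+n∸m≡n g m)) r)

  generator∈closure⇔representable : 0 < s → 0 < t → ∀ {i} → 0 < i →
    (closure s t ｛ i ｝ s ⊎ closure s t ｛ i ｝ t) ⇔ Representable s t i
  generator∈closure⇔representable 0<s 0<t {i} 0<i = mk⇔ representable generator
    where
    representable : closure s t ｛ i ｝ s ⊎ closure s t ｛ i ｝ t → Representable s t i
    representable (inj₁ s∈)
      with (_ , s≤i) , r ← to closure-singleton⇔ s∈ =
      subst (Representable s t) (m+[n∸m]≡n s≤i) (representable-s+ r)
    representable (inj₂ t∈)
      with (_ , t≤i) , r ← to closure-singleton⇔ t∈ =
      subst (Representable s t) (m+[n∸m]≡n t≤i) (representable-t+ r)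
    generator : Representable s t i → closure s t ｛ i ｝ s ⊎ closure s t ｛ i ｝ t
    generator (zero , zero , refl) = contradiction 0<i (<-irrefl refl)
    generator (suc a , b , refl) =
      inj₁ (subst (λ k → closure s t ｛ k ｝ s) (sym (+-assoc s (a * s) (b * t)))
                  (generator∈closure 0<s (a , b , refl)))
    generator (zero , suc b , refl) = inj₂ (generator∈closure 0<t (0 , b , refl))

module SingletonClosure {s t : ℕ} (0<s : 0 < s) (0<t : 0 < t) where

  representable? : ∀ m → Dec (Representable s t m)
  representable? m = Dec.map′ unbound bound
    (anyUpTo? (λ a → anyUpTo? (λ b → a * s + b * t ≟ m) (suc m)) (suc m))
    where
    unbound : (∃ λ a → a < suc m × ∃ λ b → b < suc m × a * s + b * t ≡ m) → Representable s t m
    unbound (a , _ , b , _ , e) = a , b , e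
    bound : Representable s t m → ∃ λ a → a < suc m × ∃ λ b → b < suc m × a * s + b * t ≡ m
    bound (a , b , refl) =
      a , s≤s (≤-trans (m≤m*n a s {{>-nonZero 0<s}}) (m≤m+n (a * s) (b * t))) ,
      b , s≤s (≤-trans (m≤m*n b t {{>-nonZero 0<t}}) (m≤n+m (b * t) (a * s))) , refl

  ∸-representable? : ∀ i y → Dec (Representable s t (i ∸ y))
  ∸-representable? i y = representable? (i ∸ y)

  closureUpTo : ℕ → ℕ → List ℕ
  closureUpTo i n = filter (∸-representable? i) (applyDownFrom suc n)

  closureList : ℕ → List ℕ
  closureList i = closureUpTo i i

  closureList-enumerates : ∀ i → Enumerates (closure s t ｛ i ｝) (closureList i)
  closureList-enumerates i =
    filter⁺ (∸-representable? i) >-trans (applyDownFrom⁺₂ suc i (λ _ → ≤-refl)) ,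
    λ y → ⇔.trans (∈-filter⇔ y) (⇔.sym closure-singleton⇔)
    where
    ∈-filter⇔ : ∀ y → y ∈ closureList i ⇔ ((0 < y × y ≤ i) × Representable s t (i ∸ y))
    ∈-filter⇔ y = mk⇔
      (λ y∈ → let y∈range , r = ∈-filter⁻ (∸-representable? i) y∈
              in to ∈-applyDownFrom-suc⇔ y∈range , r)
      (λ (bounds , r) → ∈-filter⁺ (∸-representable? i) (from ∈-applyDownFrom-suc⇔ bounds) r)

  closureUpTo-suc : ∀ i n →
    closureUpTo (suc i) (suc n) ≡ map suc (closureUpTo i n) ++ closureUpTo (suc i) 1
  closureUpTo-suc i zero    = refl
  closureUpTo-suc i (suc n) = shift (representable? (i ∸ suc n))
    where
    open ≡-Reasoning
    shift : Dec (Representable s t (i ∸ suc n)) →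
      closureUpTo (suc i) (suc (suc n)) ≡ map suc (closureUpTo i (suc n)) ++ closureUpTo (suc i) 1
    shift (yes r) = begin
      closureUpTo (suc i) (suc (suc n))
        ≡⟨ filter-accept (∸-representable? (suc i)) {suc (suc n)} r ⟩
      suc (suc n) ∷ closureUpTo (suc i) (suc n)
        ≡⟨ cong (suc (suc n) ∷_) (closureUpTo-suc i n) ⟩
      suc (suc n) ∷ map suc (closureUpTo i n) ++ closureUpTo (suc i) 1
        ≡⟨ cong (λ l → map suc l ++ closureUpTo (suc i) 1)
                (filter-accept (∸-representable? i) {suc n} r) ⟨
      map suc (closureUpTo i (suc n)) ++ closureUpTo (suc i) 1 ∎
    shift (no ¬r) = begin
      closureUpTo (suc i) (suc (suc n))
        ≡⟨ filter-reject (∸-representable? (suc i)) {suc (suc n)} ¬r ⟩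
      closureUpTo (suc i) (suc n)
        ≡⟨ closureUpTo-suc i n ⟩
      map suc (closureUpTo i n) ++ closureUpTo (suc i) 1
        ≡⟨ cong (λ l → map suc l ++ closureUpTo (suc i) 1)
                (filter-reject (∸-representable? i) {suc n} ¬r) ⟨
      map suc (closureUpTo i (suc n)) ++ closureUpTo (suc i) 1 ∎

  closureList-suc-representable : ∀ {i} → Representable s t i →
    closureList (suc i) ≡ map suc (closureList i) ∷ʳ 1
  closureList-suc-representable {i} r = trans (closureUpTo-suc i i)
    (cong (map suc (closureList i) ++_) (filter-accept (∸-representable? (suc i)) {1} r))

  closureList-suc-unrepresentable : ∀ {i} → ¬ Representable s t i →
    closureList (suc i) ≡ map suc (closureList i)
  closureList-suc-unrepresentable {i} ¬r = trans (closureUpTo-suc i i)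
    (trans (cong (map suc (closureList i) ++_) (filter-reject (∸-representable? (suc i)) {1} ¬r))
           (++-identityʳ (map suc (closureList i))))

  closureList-head : ∀ k → closureList (suc k) ≡ suc k ∷ closureUpTo (suc k) k
  closureList-head k = filter-accept (∸-representable? (suc k)) {suc k} (0 , 0 , sym (n∸n≡0 k))

  size : ℕ → ℕ
  size i = length (closureList i)

  size-HasSize : ∀ i → HasSize (closure s t ｛ i ｝) (size i)
  size-HasSize i = closureList i , closureList-enumerates i , refl

  HasSize⇒≡size : ∀ {i n} → HasSize (closure s t ｛ i ｝) n → n ≡ size i
  HasSize⇒≡size {i} has = HasSize-unique has (closureList-enumerates i)

  size-suc-representable : ∀ {i} → Representable s t i → size (suc i) ≡ suc (size i)
  size-suc-representable {i} r = begin
    size (suc i)                        ≡⟨ cong length (closureList-suc-representable r) ⟩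
    length (map suc (closureList i) ∷ʳ 1) ≡⟨ length-∷ʳ (map suc (closureList i)) 1 ⟩
    suc (length (map suc (closureList i))) ≡⟨ cong suc (length-map suc (closureList i)) ⟩
    suc (size i)                        ∎
    where open ≡-Reasoning

  size-suc-unrepresentable : ∀ {i} → ¬ Representable s t i → size (suc i) ≡ size i
  size-suc-unrepresentable {i} ¬r =
    trans (cong length (closureList-suc-unrepresentable ¬r)) (length-map suc (closureList i))

  size-≤-suc : ∀ i → size i ≤ size (suc i)
  size-≤-suc i with representable? i
  ... | yes r = ≤-trans (n≤1+n (size i)) (≤-reflexive (sym (size-suc-representable r)))
  ... | no ¬r = ≤-reflexive (sym (size-suc-unrepresentable ¬r))

  size-suc-≤ : ∀ i → size (suc i) ≤ suc (size i)
  size-suc-≤ i with representable? i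
  ... | yes r = ≤-reflexive (size-suc-representable r)
  ... | no ¬r = ≤-trans (≤-reflexive (size-suc-unrepresentable ¬r)) (n≤1+n (size i))

  size-mono-≤ : ∀ {i j} → i ≤ j → size i ≤ size j
  size-mono-≤ = stepwise⇒monotone {_≲_ = _≤_} ≤-refl ≤-trans size size-≤-suc

  size-≤ : ∀ i → size i ≤ i
  size-≤ i = ≤-trans (length-filter (∸-representable? i) (applyDownFrom suc i))
                     (≤-reflexive (length-applyDownFrom suc i))

  size-unbounded : ∀ n → n ≤ size (n * s)
  size-unbounded zero    = z≤n
  size-unbounded (suc n) = begin
    suc n              ≤⟨ s≤s (size-unbounded n) ⟩
    suc (size (n * s)) ≡⟨ size-suc-representable (n , 0 , +-identityʳ (n * s)) ⟨
    size (suc (n * s)) ≤⟨ size-mono-≤ (+-monoˡ-≤ (n * s) 0<s) ⟩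
    size (s + n * s)   ∎
    where open ≤-Reasoning

  size-attains : ∀ n → ∃ λ i → size i ≡ n
  size-attains n = unitSteps⇒attains size refl size-suc-≤ (n * s) (size-unbounded n)

  size-<⇒< : ∀ {a b m n} → HasSize (closure s t ｛ a ｝) m → HasSize (closure s t ｛ b ｝) n →
    m < n → a < b
  size-<⇒< ha hb m<n = ≰⇒> λ b≤a →
    <⇒≱ (subst₂ _<_ (HasSize⇒≡size ha) (HasSize⇒≡size hb) m<n) (size-mono-≤ b≤a)

  partitionOf-closureList-⊴-suc : ∀ i → partitionOf (closureList i) ⊴ partitionOf (closureList (suc i))
  partitionOf-closureList-⊴-suc i with representable? i
  ... | yes r rewrite closureList-suc-representable r | partitionOf-map-suc-∷ʳ-1 (closureList i) =
    ⊴-++ (partitionOf (closureList i)) (1 ∷ [])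
  ... | no ¬r rewrite closureList-suc-unrepresentable ¬r = partitionOf-⊴-map-suc (closureList i)

  closure-≤⇒≺ : ∀ {a b} → a ≤ b → closure s t ｛ a ｝ ≺ closure s t ｛ b ｝
  closure-≤⇒≺ {a} {b} a≤b = closureList a , closureList b ,
    closureList-enumerates a , closureList-enumerates b ,
    stepwise⇒monotone {_≲_ = _⊴_} ⊴-refl ⊴-trans (partitionOf ∘ closureList)
                      partitionOf-closureList-⊴-suc a≤b

  closure-≺⇒≤ : ∀ {a b} → 0 < a → 0 < b → closure s t ｛ a ｝ ≺ closure s t ｛ b ｝ → a ≤ b
  closure-≺⇒≤ {suc a} {suc b} z<s z<s (xs , ys , xs-enum , ys-enum , xs⊴ys)
    with ≤-total (suc a) (suc b)
  ... | inj₁ a≤b = a≤b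
  ... | inj₂ b≤a = partitionOf-⊴⇒head≤ heads⊴
    (s≤s⁻¹ (subst₂ _≤_ (size-head b) (size-head a) (size-mono-≤ b≤a)))
    (≤-trans (s≤s⁻¹ (subst (_≤ suc b) (size-head b) (size-≤ (suc b)))) (n≤1+n b))
    where
    listed : ∀ {k zs} → Enumerates (closure s t ｛ suc k ｝) zs → zs ≡ suc k ∷ closureUpTo (suc k) k
    listed {k} enum =
      trans (Enumerates-unique enum (closureList-enumerates (suc k))) (closureList-head k)
    heads⊴ : partitionOf (suc a ∷ closureUpTo (suc a) a) ⊴ partitionOf (suc b ∷ closureUpTo (suc b) b)
    heads⊴ = subst₂ (λ u v → partitionOf u ⊴ partitionOf v) (listed xs-enum) (listed ys-enum) xs⊴ys
    size-head : ∀ k → size (suc k) ≡ suc (length (closureUpTo (suc k) k))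
    size-head k = cong length (closureList-head k)

theorem3p1 : (s t : ℕ) → 0 < s → s < t → Coprime s t →
  ((i j : ℕ) → 0 < i → 0 < j →
     (closure s t ｛ i ｝ ⊖ j) ≐ closure s t ｛ i ∸ j ｝)
  ×
  ((i j : ℕ) → 0 < i → 0 < j →
     closure s t (closure s t ｛ i ｝ ⊕ j) ≐ closure s t ｛ i + j ｝)
  ×
  ((i : ℕ) → 0 < i →
     ((¬ closure s t ｛ i ｝ s × ¬ closure s t ｛ i ｝ t) →
        Σ ℕ λ n → HasSize (closure s t ｛ i ｝) n
                × HasSize (closure s t ｛ suc i ｝) n)
     ×
     ((closure s t ｛ i ｝ s ⊎ closure s t ｛ i ｝ t) →
        Σ ℕ λ n → HasSize (closure s t ｛ i ｝) n
                × HasSize (closure s t ｛ suc i ｝) (suc n)))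
  ×
  ((n : ℕ) → Σ ℕ λ i → HasSize (closure s t ｛ i ｝) n)
  ×
  ((a b : ℕ) → 0 < a → 0 < b →
     (a ≤ b) ⇔ (closure s t ｛ a ｝ ≺ closure s t ｛ b ｝))
  ×
  ((a b : ℕ) → 0 < a → 0 < b → (m n : ℕ) →
     HasSize (closure s t ｛ a ｝) m → HasSize (closure s t ｛ b ｝) n →
     m < n → a < b)
theorem3p1 s t 0<s s<t _ =
    (λ i j _ _ → closure-singleton-⊖ i j)
  , (λ i j 0<i _ → closure-closure-singleton-⊕ 0<i j)
  , (λ i 0<i →
        (λ (s∉ , t∉) → size i , size-HasSize i ,
           subst (HasSize _) (size-suc-unrepresentable λ r → [ s∉ , t∉ ]′ (from (generators 0<i) r))
                 (size-HasSize (suc i)))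
      , (λ s∨t∈ → size i , size-HasSize i ,
           subst (HasSize _) (size-suc-representable (to (generators 0<i) s∨t∈))
                 (size-HasSize (suc i))))
  , (λ n → let i , size≡n = size-attains n in i , subst (HasSize _) size≡n (size-HasSize i))
  , (λ a b 0<a 0<b → mk⇔ closure-≤⇒≺ (closure-≺⇒≤ 0<a 0<b))
  , (λ a b _ _ m n → size-<⇒<)
  where
  0<t : 0 < t
  0<t = <-trans 0<s s<t
  open SingletonClosure 0<s 0<t
  generators : ∀ {i} → 0 < i → (closure s t ｛ i ｝ s ⊎ closure s t ｛ i ｝ t) ⇔ Representable s t i
  generators = generator∈closure⇔representable 0<s 0<t
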